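{- Let $G$ be a graph of order $n$ and size $m$. Then for every $i$ with $1\le i\le n-1$, $$a_i(G)\le \frac{1}{(n-i)!}\left(\binom{n}{2}-m\right)^{n-i}.$$
   Context: All graphs are finite and simple. For a graph $G$, an $i$-colour partition of $G$ is a partition of $V(G)$ into exactly $i$ nonempty independent sets, and $a_i(G)$ denotes the number of $i$-colour partitions of $G$. -}

module Defs where

open import Data.Bool using (Bool; true; false; _∧_; _∨_; not; if_then_else_)
open import Data.Nat using (ℕ; zero; suc)
open import Data.Fin using (Fin; zero; suc; inject₁; _<?_; toℕ)
open import Data.Fin.Properties using (_≟_)
open import Data.List using (List; []; _∷_; map; concatMap; allFin)
open import Data.Bool.ListAction using (and; or)
open import Data.Vec using (Vec; []; _∷_; lookup)
open import Relation.Nullary.Decidable using (⌊_⌋)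
open import Relation.Binary.PropositionalEquality using (_≡_)

record Graph (n : ℕ) : Set where
  field
    adj    : Fin n → Fin n → Bool
    sym    : ∀ u v → adj u v ≡ adj v u
    irrefl : ∀ v → adj v v ≡ false
open Graph public

_==_ : ∀ {k} → Fin k → Fin k → Bool
x == y = ⌊ x ≟ y ⌋

_<ᵇ_ : ∀ {k} → Fin k → Fin k → Bool
x <ᵇ y = ⌊ x <? y ⌋

count : ∀ {A : Set} → (A → Bool) → List A → ℕ
count p [] = zero
count p (x ∷ xs) = if p x then suc (count p xs) else count p xs

size : ∀ {n} → Graph n → ℕ
size {n} G = count (λ b → b)
                 (concatMap (λ u → map (λ v → (u <ᵇ v) ∧ adj G u v) (allFin n)) (allFin n))

allVecs : (i n : ℕ) → List (Vec (Fin i) n)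
allVecs i zero = [] ∷ []
allVecs i (suc n) = concatMap (λ x → map (x ∷_) (allVecs i n)) (allFin i)

proper : ∀ {i n} → Graph n → Vec (Fin i) n → Bool
proper {i} {n} G c =
  and (map (λ u → and (map (λ v → not (adj G u v ∧ (lookup c u == lookup c v))) (allFin n))) (allFin n))

surjective : ∀ {i n} → Vec (Fin i) n → Bool
surjective {i} {n} c = and (map (λ k → or (map (λ v → lookup c v == k) (allFin n))) (allFin i))

-- canonical labelling of the blocks: blocks are numbered in increasing
-- order of their least vertex.  Equivalently: whenever vertex v has
-- colour k+1, some earlier vertex u < v has colour k.
canonicalᵇ : ∀ {i} → Fin (suc i) → ∀ {n} → Vec (Fin (suc i)) n → Fin n → Bool
canonicalᵇ zero    c v = true
canonicalᵇ (suc k) {n} c v = or (map (λ u → (u <ᵇ v) ∧ (lookup c u == inject₁ k)) (allFin n))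

canonical : ∀ {i n} → Vec (Fin i) n → Bool
canonical {zero} {n} c = true
canonical {suc i} {n} c = and (map (λ v → canonicalᵇ (lookup c v) c v) (allFin n))

-- a i G = number of i-colour partitions of G, i.e. partitions of V(G)
-- into exactly i nonempty independent sets.  Each such partition is
-- counted exactly once via its canonical labelling by Fin i.
a : (i : ℕ) → ∀ {n} → Graph n → ℕ
a i {n} G = count (λ c → proper G c ∧ surjective c ∧ canonical c) (allVecs i n)

-- Delete the last vertex v of G and restrict a canonical (j+1)-colour
-- partition of G to G − v.  Either v forms a singleton block, which by
-- canonicity carries the top colour, and the restriction is a j-colour
-- partition of G − v; or the restriction is still a (j+1)-colour
-- partition of G − v and v shares its block with one of the k vertices of
-- G − v it is not adjacent to.  Hence
--   a_{j+1}(G) ≤ a_j(G − v) + k · a_{j+1}(G − v),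
-- while the number N of non-edges satisfies N(G) = N(G − v) + k.  Induction
-- on n and the inequality N^{q+1} + (q+1) k N^q ≤ (N + k)^{q+1} then give
-- a_i(G) · (n − i)! ≤ N(G)^{n−i}, and N(G) = C(n,2) − m.

module Submission where

open import Defs
open import Data.Nat using (ℕ; _≤_; _*_; _∸_; _^_; _!)
open import Data.Nat.Combinatorics using (_C_)

open import Data.Nat using (zero; suc; pred; _+_; _<_; z≤n; s≤s; s≤s⁻¹; _≤?_)
open import Data.Nat.Properties
open import Data.Nat.Combinatorics using (nCk+nC[k+1]≡[n+1]C[k+1]; nC1≡n)
open import Data.Nat.Tactic.RingSolver using (solve-∀)
open import Algebra.Properties.Semiring.Sum +-*-semiring
  using (sum; sum-syntax; sum-cong-≗; sum-init-last; sum-replicate-zero;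
         ∑-distrib-+; ∑-comm; *-distribˡ-sum; *-distribʳ-sum)
open import Data.Bool using (Bool; true; false; T; _∧_; not; if_then_else_)
open import Data.Bool.Properties using (T-∧; T-≡; T-not-≡)
open import Data.Bool.ListAction using (all; any)
open import Data.Fin using (Fin; zero; suc; inject₁; fromℕ; toℕ; lower₁)
import Data.Fin.Properties as Finₚ
open import Data.List using (List; []; _∷_; _++_; map; concatMap; tabulate; allFin)
import Data.List.Relation.Unary.All.Properties as Allₚ
import Data.List.Relation.Unary.Any.Properties as Anyₚ
open import Data.Vec using (Vec; []; _∷_; lookup; _∷ʳ_)
import Data.Vec as Vec
open import Data.Vec.Properties using (lookup-map)
open import Data.Product using (∃; _×_; _,_; proj₁; proj₂)
open import Data.Sum using (_⊎_; inj₁; inj₂)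
open import Data.Empty using (⊥-elim)
open import Data.Unit using (tt)
open import Function using (_∘_; id; Equivalence)
open import Relation.Binary.PropositionalEquality as ≡
  using (_≡_; _≢_; refl; cong; cong₂; subst; subst₂; trans)
open import Relation.Nullary using (¬_; yes; no)
open import Relation.Nullary.Decidable using (⌊_⌋; toWitness; fromWitness; fromWitnessFalse)

open Equivalence using (to; from)

⟦_⟧ : Bool → ℕ
⟦ b ⟧ = if b then 1 else 0

⟦⟧≤1 : ∀ b → ⟦ b ⟧ ≤ 1
⟦⟧≤1 true  = ≤-refl
⟦⟧≤1 false = z≤n

⟦⟧-mono : ∀ {b b′} → (T b → T b′) → ⟦ b ⟧ ≤ ⟦ b′ ⟧
⟦⟧-mono {false}         _ = z≤n
⟦⟧-mono {true} {true}   _ = ≤-refl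
⟦⟧-mono {true} {false} h = ⊥-elim (h tt)

T⇒⟦⟧≡1 : ∀ b → T b → ⟦ b ⟧ ≡ 1
T⇒⟦⟧≡1 true _ = refl

⟦∧⟧+⟦∧not⟧ : ∀ b r → ⟦ b ∧ r ⟧ + ⟦ b ∧ not r ⟧ ≡ ⟦ b ∧ true ⟧
⟦∧⟧+⟦∧not⟧ false _     = refl
⟦∧⟧+⟦∧not⟧ true  true  = refl
⟦∧⟧+⟦∧not⟧ true  false = refl

T-not⁺ : ∀ {b} → ¬ T b → T (not b)
T-not⁺ {false} _  = tt
T-not⁺ {true}  ¬t = ¬t tt

T-not⁻ : ∀ {b} → T (not b) → ¬ T b
T-not⁻ {true} ()

==-refl : ∀ {k} (x : Fin k) → (x == x) ≡ true
==-refl x = to T-≡ (fromWitness refl)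

==-≢ : ∀ {k} {x y : Fin k} → x ≢ y → (x == y) ≡ false
==-≢ x≢y = to T-not-≡ (fromWitnessFalse x≢y)

all-allFin⁻ : ∀ {n} (f : Fin n → Bool) → T (all f (allFin n)) → ∀ v → T (f v)
all-allFin⁻ f t = Allₚ.tabulate⁻ (Allₚ.all⁺ f (allFin _) t)

all-allFin⁺ : ∀ {n} (f : Fin n → Bool) → (∀ v → T (f v)) → T (all f (allFin n))
all-allFin⁺ f h = Allₚ.all⁻ f (Allₚ.tabulate⁺ h)

any-allFin⁻ : ∀ {n} (f : Fin n → Bool) → T (any f (allFin n)) → ∃ λ v → T (f v)
any-allFin⁻ f t = Anyₚ.tabulate⁻ (Anyₚ.any⁻ f (allFin _) t)

any-allFin⁺ : ∀ {n} (f : Fin n → Bool) v → T (f v) → T (any f (allFin n))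
any-allFin⁺ f v t = Anyₚ.any⁺ f (Anyₚ.tabulate⁺ v t)

-- Finite sums

sum-mono-≤ : ∀ {n} {f g : Fin n → ℕ} → (∀ i → f i ≤ g i) → sum f ≤ sum g
sum-mono-≤ {zero}  _   = z≤n
sum-mono-≤ {suc n} f≤g = +-mono-≤ (f≤g zero) (sum-mono-≤ (f≤g ∘ suc))

term≤sum : ∀ {n} (f : Fin n → ℕ) i → f i ≤ sum f
term≤sum f zero    = m≤m+n _ _
term≤sum f (suc i) = ≤-trans (term≤sum (f ∘ suc) i) (m≤n+m _ _)

sum-ones : ∀ n → ∑[ i < n ] 1 ≡ n
sum-ones zero    = refl
sum-ones (suc n) = cong suc (sum-ones n)

sum-supported : ∀ {n} (f : Fin n → ℕ) y → (∀ x → y ≢ x → f x ≡ 0) → sum f ≡ f y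
sum-supported {suc n} f zero    f≡0 = trans
  (cong (f zero +_) (trans (sum-cong-≗ (λ x → f≡0 (suc x) λ ())) (sum-replicate-zero n)))
  (+-identityʳ (f zero))
sum-supported {suc n} f (suc y) f≡0 =
  cong₂ _+_ (f≡0 zero λ ())
            (sum-supported (f ∘ suc) y (λ x y≢x → f≡0 (suc x) (y≢x ∘ Finₚ.suc-injective)))

sum-indicator : ∀ {m} (y : Fin m) K → ∑[ x < m ] (⟦ y == x ⟧ * K) ≡ K
sum-indicator y K = trans
  (sum-supported _ y (λ x y≢x → cong (λ b → ⟦ b ⟧ * K) (==-≢ y≢x)))
  (trans (cong (λ b → ⟦ b ⟧ * K) (==-refl y)) (+-identityʳ K))

sum-fibres : ∀ {m n} (g : Fin n → Fin m) (q : Fin n → ℕ) →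
             ∑[ x < m ] ∑[ u < n ] (⟦ g u == x ⟧ * q u) ≡ ∑[ u < n ] q u
sum-fibres g q = trans (∑-comm (λ x u → ⟦ g u == x ⟧ * q u))
                       (sum-cong-≗ (λ u → sum-indicator (g u) (q u)))

count-++ : ∀ {A : Set} (p : A → Bool) xs ys → count p (xs ++ ys) ≡ count p xs + count p ys
count-++ p []       ys = refl
count-++ p (x ∷ xs) ys with p x
... | true  = cong suc (count-++ p xs ys)
... | false = count-++ p xs ys

count-map : ∀ {A B : Set} (p : B → Bool) (f : A → B) xs → count p (map f xs) ≡ count (p ∘ f) xs
count-map p f []       = refl
count-map p f (x ∷ xs) with p (f x)
... | true  = cong suc (count-map p f xs)
... | false = count-map p f xs

count-tabulate : ∀ {A : Set} {n} (p : A → Bool) (f : Fin n → A) →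
                 count p (tabulate f) ≡ ∑[ i < n ] ⟦ p (f i) ⟧
count-tabulate {n = zero}  p f = refl
count-tabulate {n = suc n} p f with p (f zero)
... | true  = cong suc (count-tabulate p (f ∘ suc))
... | false = count-tabulate p (f ∘ suc)

count-concatMap-tabulate : ∀ {A B : Set} {n} (p : B → Bool) (g : A → List B) (f : Fin n → A) →
                           count p (concatMap g (tabulate f)) ≡ ∑[ i < n ] count p (g (f i))
count-concatMap-tabulate {n = zero}  p g f = refl
count-concatMap-tabulate {n = suc n} p g f =
  trans (count-++ p (g (f zero)) _) (cong (count p (g (f zero)) +_) (count-concatMap-tabulate p g (f ∘ suc)))

∑ᵛ : ∀ {i n} → (Vec (Fin i) n → ℕ) → ℕ
∑ᵛ {n = zero}      f = f []
∑ᵛ {i} {n = suc n} f = ∑[ x < i ] ∑ᵛ (λ c → f (x ∷ c))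

count-allVecs : ∀ {i} n (p : Vec (Fin i) n → Bool) → count p (allVecs i n) ≡ ∑ᵛ (⟦_⟧ ∘ p)
count-allVecs zero    p = refl
count-allVecs {i} (suc n) p = begin
  count p (concatMap (λ x → map (x ∷_) (allVecs i n)) (allFin i))
    ≡⟨ count-concatMap-tabulate p (λ x → map (x ∷_) (allVecs i n)) id ⟩
  ∑[ x < i ] count p (map (x ∷_) (allVecs i n))
    ≡⟨ sum-cong-≗ (λ x → trans (count-map p (x ∷_) (allVecs i n)) (count-allVecs n (p ∘ (x ∷_)))) ⟩
  ∑ᵛ (⟦_⟧ ∘ p) ∎
  where open ≡.≡-Reasoning

∑ᵛ-mono-≤ : ∀ {i n} {f g : Vec (Fin i) n → ℕ} → (∀ c → f c ≤ g c) → ∑ᵛ f ≤ ∑ᵛ g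
∑ᵛ-mono-≤ {n = zero}  f≤g = f≤g []
∑ᵛ-mono-≤ {n = suc n} f≤g = sum-mono-≤ (λ x → ∑ᵛ-mono-≤ (λ c → f≤g (x ∷ c)))

∑ᵛ-zero : ∀ {i} n → ∑ᵛ {i} {n} (λ _ → 0) ≡ 0
∑ᵛ-zero     zero    = refl
∑ᵛ-zero {i} (suc n) = trans (sum-cong-≗ {i} (λ _ → ∑ᵛ-zero {i} n)) (sum-replicate-zero i)

∑ᵛ-distrib-+ : ∀ {i n} (f g : Vec (Fin i) n → ℕ) → ∑ᵛ (λ c → f c + g c) ≡ ∑ᵛ f + ∑ᵛ g
∑ᵛ-distrib-+ {n = zero}  f g = refl
∑ᵛ-distrib-+ {n = suc n} f g = trans (sum-cong-≗ (λ x → ∑ᵛ-distrib-+ (f ∘ (x ∷_)) (g ∘ (x ∷_))))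
  (∑-distrib-+ (λ x → ∑ᵛ (f ∘ (x ∷_))) (λ x → ∑ᵛ (g ∘ (x ∷_))))

*-distribʳ-∑ᵛ : ∀ {i n} k (f : Vec (Fin i) n → ℕ) → ∑ᵛ f * k ≡ ∑ᵛ (λ c → f c * k)
*-distribʳ-∑ᵛ {n = zero}  k f = refl
*-distribʳ-∑ᵛ {n = suc n} k f = trans (*-distribʳ-sum k (λ x → ∑ᵛ (f ∘ (x ∷_))))
  (sum-cong-≗ (λ x → *-distribʳ-∑ᵛ k (f ∘ (x ∷_))))

∑ᵛ-∷ʳ : ∀ {i} n (f : Vec (Fin i) (suc n) → ℕ) → ∑ᵛ f ≡ ∑ᵛ (λ c → ∑[ x < i ] f (c ∷ʳ x))
∑ᵛ-∷ʳ zero    f = refl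
∑ᵛ-∷ʳ (suc n) f = sum-cong-≗ (λ y → ∑ᵛ-∷ʳ n (λ c → f (y ∷ c)))

avoidsTop : ∀ {j n} → Vec (Fin (suc j)) n → Bool
avoidsTop     []      = true
avoidsTop {j} (y ∷ c) = not (y == fromℕ j) ∧ avoidsTop c

∑ᵛ-avoidsTop : ∀ {j} n (f : Vec (Fin (suc j)) n → ℕ) →
               ∑ᵛ (λ c → ⟦ avoidsTop c ⟧ * f c) ≡ ∑ᵛ (f ∘ Vec.map inject₁)
∑ᵛ-avoidsTop     zero    f = +-identityʳ (f [])
∑ᵛ-avoidsTop {j} (suc n) f = begin
  ∑[ y < suc j ] g y                        ≡⟨ sum-init-last g ⟩
  ∑[ y < j ] g (inject₁ y) + g (fromℕ j)    ≡⟨ cong₂ _+_ (sum-cong-≗ below-top) top ⟩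
  ∑ᵛ (f ∘ Vec.map inject₁) + 0              ≡⟨ +-identityʳ _ ⟩
  ∑ᵛ (f ∘ Vec.map inject₁)                  ∎
  where
  open ≡.≡-Reasoning
  g : Fin (suc j) → ℕ
  g y = ∑ᵛ (λ c → ⟦ avoidsTop (y ∷ c) ⟧ * f (y ∷ c))
  below-top : ∀ y → g (inject₁ y) ≡ ∑ᵛ (λ d → f (inject₁ y ∷ Vec.map inject₁ d))
  below-top y rewrite ==-≢ (Finₚ.fromℕ≢inject₁ {i = y} ∘ ≡.sym) = ∑ᵛ-avoidsTop n (f ∘ (inject₁ y ∷_))
  top : g (fromℕ j) ≡ 0
  top rewrite ==-refl (fromℕ j) = ∑ᵛ-zero n

lookup-∷ʳ-inject₁ : ∀ {A : Set} {n} (c : Vec A n) x v → lookup (c ∷ʳ x) (inject₁ v) ≡ lookup c v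
lookup-∷ʳ-inject₁ (y ∷ c) x zero    = refl
lookup-∷ʳ-inject₁ (y ∷ c) x (suc v) = lookup-∷ʳ-inject₁ c x v

lookup-∷ʳ-fromℕ : ∀ {A : Set} {n} (c : Vec A n) x → lookup (c ∷ʳ x) (fromℕ n) ≡ x
lookup-∷ʳ-fromℕ []      x = refl
lookup-∷ʳ-fromℕ (y ∷ c) x = lookup-∷ʳ-fromℕ c x

toℕ<⇒inject₁ : ∀ {n} (w : Fin (suc n)) → toℕ w < n → ∃ λ v → w ≡ inject₁ v
toℕ<⇒inject₁ w w<n = lower₁ w (>⇒≢ w<n) , ≡.sym (Finₚ.inject₁-lower₁ w (>⇒≢ w<n))

inject₁-or-fromℕ : ∀ {n} (w : Fin (suc n)) → (∃ λ v → w ≡ inject₁ v) ⊎ w ≡ fromℕ n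
inject₁-or-fromℕ {n} w with m≤n⇒m<n∨m≡n (Finₚ.toℕ≤pred[n] w)
... | inj₁ w<n = inj₁ (toℕ<⇒inject₁ w w<n)
... | inj₂ w≡n = inj₂ (Finₚ.toℕ-injective (trans w≡n (≡.sym (Finₚ.toℕ-fromℕ n))))

<ᵇ-inject₁ : ∀ {n} (u v : Fin n) → (inject₁ u <ᵇ inject₁ v) ≡ (u <ᵇ v)
<ᵇ-inject₁ u v = cong₂ (λ x y → ⌊ suc x ≤? y ⌋) (Finₚ.toℕ-inject₁ u) (Finₚ.toℕ-inject₁ v)

fromℕ<ᵇ : ∀ {n} (v : Fin (suc n)) → (fromℕ n <ᵇ v) ≡ false
fromℕ<ᵇ v = to T-not-≡ (fromWitnessFalse (≤⇒≯ (Finₚ.≤fromℕ v)))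

inject₁<ᵇfromℕ : ∀ {n} (u : Fin n) → (inject₁ u <ᵇ fromℕ n) ≡ true
inject₁<ᵇfromℕ {n} u =
  to T-≡ (fromWitness (subst (toℕ (inject₁ u) <_) (≡.sym (Finₚ.toℕ-fromℕ n)) (Finₚ.inject₁ℕ< u)))

below-inject₁ : ∀ {n} (w : Fin (suc n)) (v : Fin n) → toℕ w < toℕ (inject₁ v) →
                ∃ λ u → w ≡ inject₁ u × toℕ u < toℕ v
below-inject₁ w v w<v with toℕ<⇒inject₁ w (<-trans w<v (Finₚ.inject₁ℕ< v))
... | u , refl = u , refl , subst₂ _<_ (Finₚ.toℕ-inject₁ u) (Finₚ.toℕ-inject₁ v) w<v

-- Edges and non-edges

deleteLast : ∀ {n} → Graph (suc n) → Graph n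
deleteLast G = record
  { adj    = λ u v → adj G (inject₁ u) (inject₁ v)
  ; sym    = λ u v → sym G (inject₁ u) (inject₁ v)
  ; irrefl = λ v → irrefl G (inject₁ v)
  }

nonNeighbour : ∀ {n} → Graph (suc n) → Fin n → Bool
nonNeighbour {n} G u = not (adj G (inject₁ u) (fromℕ n))

nonDegree : ∀ {n} → Graph (suc n) → ℕ
nonDegree {n} G = ∑[ u < n ] ⟦ nonNeighbour G u ⟧

pairCount : ∀ {n} → (Fin n → Fin n → Bool) → ℕ
pairCount {n} R = ∑[ u < n ] ∑[ v < n ] ⟦ (u <ᵇ v) ∧ R u v ⟧

nonEdges : ∀ {n} → Graph n → ℕ
nonEdges G = pairCount (λ u v → not (adj G u v))

size≡pairCount : ∀ {n} (G : Graph n) → size G ≡ pairCount (adj G)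
size≡pairCount {n} G = trans (count-concatMap-tabulate id row id)
  (sum-cong-≗ (λ u → trans (count-map id _ (allFin n)) (count-tabulate (λ v → (u <ᵇ v) ∧ adj G u v) id)))
  where
  row : Fin n → List Bool
  row u = map (λ v → (u <ᵇ v) ∧ adj G u v) (allFin n)

pairCount-init-last : ∀ {n} (R : Fin (suc n) → Fin (suc n) → Bool) →
  pairCount R ≡ pairCount (λ u v → R (inject₁ u) (inject₁ v)) + ∑[ u < n ] ⟦ R (inject₁ u) (fromℕ n) ⟧
pairCount-init-last {n} R = begin
  ∑[ u < suc n ] row u                            ≡⟨ sum-init-last row ⟩
  ∑[ u < n ] row (inject₁ u) + row (fromℕ n)      ≡⟨ cong₂ _+_ (sum-cong-≗ row-inject₁) last-row ⟩
  ∑[ u < n ] (inner u + ⟦ R (inject₁ u) (fromℕ n) ⟧) + 0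
                                                  ≡⟨ +-identityʳ _ ⟩
  ∑[ u < n ] (inner u + ⟦ R (inject₁ u) (fromℕ n) ⟧)
                                                  ≡⟨ ∑-distrib-+ inner (λ u → ⟦ R (inject₁ u) (fromℕ n) ⟧) ⟩
  ∑[ u < n ] inner u + ∑[ u < n ] ⟦ R (inject₁ u) (fromℕ n) ⟧ ∎
  where
  open ≡.≡-Reasoning
  row : Fin (suc n) → ℕ
  row u = ∑[ v < suc n ] ⟦ (u <ᵇ v) ∧ R u v ⟧
  inner : Fin n → ℕ
  inner u = ∑[ v < n ] ⟦ (u <ᵇ v) ∧ R (inject₁ u) (inject₁ v) ⟧
  row-inject₁ : ∀ u → row (inject₁ u) ≡ inner u + ⟦ R (inject₁ u) (fromℕ n) ⟧
  row-inject₁ u = trans (sum-init-last (λ v → ⟦ (inject₁ u <ᵇ v) ∧ R (inject₁ u) v ⟧)) (cong₂ _+_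
    (sum-cong-≗ (λ v → cong (λ b → ⟦ b ∧ R (inject₁ u) (inject₁ v) ⟧) (<ᵇ-inject₁ u v)))
    (cong (λ b → ⟦ b ∧ R (inject₁ u) (fromℕ n) ⟧) (inject₁<ᵇfromℕ u)))
  last-row : row (fromℕ n) ≡ 0
  last-row = trans (sum-cong-≗ (λ v → cong (λ b → ⟦ b ∧ R (fromℕ n) v ⟧) (fromℕ<ᵇ v)))
                   (sum-replicate-zero (suc n))

pairCount-not : ∀ {n} (R : Fin n → Fin n → Bool) →
                pairCount R + pairCount (λ u v → not (R u v)) ≡ pairCount {n} (λ _ _ → true)
pairCount-not {n} R = trans (≡.sym (∑-distrib-+ (row R) (row R̄))) (sum-cong-≗ complementary)
  where
  R̄ : Fin n → Fin n → Bool
  R̄ u v = not (R u v)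
  row : (Fin n → Fin n → Bool) → Fin n → ℕ
  row S u = ∑[ v < n ] ⟦ (u <ᵇ v) ∧ S u v ⟧
  complementary : ∀ u → row R u + row R̄ u ≡ ∑[ v < n ] ⟦ (u <ᵇ v) ∧ true ⟧
  complementary u = trans (≡.sym (∑-distrib-+ (λ v → ⟦ (u <ᵇ v) ∧ R u v ⟧) (λ v → ⟦ (u <ᵇ v) ∧ R̄ u v ⟧)))
                          (sum-cong-≗ (λ v → ⟦∧⟧+⟦∧not⟧ (u <ᵇ v) (R u v)))

pairCount-true : ∀ n → pairCount {n} (λ _ _ → true) ≡ n C 2
pairCount-true zero    = refl
pairCount-true (suc n) = begin
  pairCount {suc n} (λ _ _ → true)  ≡⟨ pairCount-init-last {n} (λ _ _ → true) ⟩
  pairCount {n} (λ _ _ → true) + ∑[ u < n ] 1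
                                    ≡⟨ cong₂ _+_ (pairCount-true n) (sum-ones n) ⟩
  n C 2 + n                         ≡⟨ +-comm (n C 2) n ⟩
  n + n C 2                         ≡⟨ cong (_+ n C 2) (nC1≡n n) ⟨
  n C 1 + n C 2                     ≡⟨ nCk+nC[k+1]≡[n+1]C[k+1] n 1 ⟩
  suc n C 2                         ∎
  where open ≡.≡-Reasoning

size+nonEdges : ∀ {n} (G : Graph n) → size G + nonEdges G ≡ n C 2
size+nonEdges {n} G = trans (cong (_+ nonEdges G) (size≡pairCount G))
                            (trans (pairCount-not (adj G)) (pairCount-true n))

C2∸size≡nonEdges : ∀ {n} (G : Graph n) → n C 2 ∸ size G ≡ nonEdges G
C2∸size≡nonEdges G = trans (cong (_∸ size G) (≡.sym (size+nonEdges G))) (m+n∸m≡n (size G) (nonEdges G))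

nonEdges-deleteLast : ∀ {n} (G : Graph (suc n)) → nonEdges G ≡ nonEdges (deleteLast G) + nonDegree G
nonEdges-deleteLast G = pairCount-init-last (λ u v → not (adj G u v))

-- Colour partitions

Proper : ∀ {i n} → Graph n → Vec (Fin i) n → Set
Proper G c = ∀ u v → T (adj G u v) → lookup c u ≢ lookup c v

Onto : ∀ {i n} → Vec (Fin i) n → Set
Onto {i} c = ∀ (k : Fin i) → ∃ λ w → lookup c w ≡ k

-- Phrased through toℕ so that it needs no case distinction on the number of colours.
Canonical : ∀ {i n} → Vec (Fin i) n → Set
Canonical c = ∀ v m → toℕ (lookup c v) ≡ suc m → ∃ λ u → toℕ u < toℕ v × toℕ (lookup c u) ≡ m

record IsPartition {i n} (G : Graph n) (c : Vec (Fin i) n) : Set where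
  field
    isProper    : Proper G c
    isOnto      : Onto c
    isCanonical : Canonical c
open IsPartition

partitionᵇ : ∀ {i n} → Graph n → Vec (Fin i) n → Bool
partitionᵇ G c = proper G c ∧ surjective c ∧ canonical c

proper⁻ : ∀ {i n} (G : Graph n) (c : Vec (Fin i) n) → T (proper G c) → Proper G c
proper⁻ G c t u v uv cu≡cv =
  T-not⁻ (all-allFin⁻ _ (all-allFin⁻ _ t u) v) (from T-∧ (uv , fromWitness cu≡cv))

proper⁺ : ∀ {i n} (G : Graph n) (c : Vec (Fin i) n) → Proper G c → T (proper G c)
proper⁺ G c P = all-allFin⁺ _ λ u → all-allFin⁺ _ λ v →
  T-not⁺ λ t → P u v (proj₁ (to (T-∧ {adj G u v}) t)) (toWitness (proj₂ (to (T-∧ {adj G u v}) t)))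

onto⁻ : ∀ {i n} (c : Vec (Fin i) n) → T (surjective c) → Onto c
onto⁻ c t k with any-allFin⁻ _ (all-allFin⁻ _ t k)
... | w , cw≡k = w , toWitness cw≡k

onto⁺ : ∀ {i n} (c : Vec (Fin i) n) → Onto c → T (surjective c)
onto⁺ c O = all-allFin⁺ _ λ k → any-allFin⁺ _ (proj₁ (O k)) (fromWitness (proj₂ (O k)))

canonical⁻ : ∀ {i n} (c : Vec (Fin i) n) → T (canonical c) → Canonical c
canonical⁻ {zero}  c _ v = ⊥-elim (Finₚ.¬Fin0 (lookup c v))
canonical⁻ {suc i} c t v m cv≡1+m with lookup c v | all-allFin⁻ _ t v
... | suc k | tv with any-allFin⁻ _ tv
...   | u , tu with to (T-∧ {u <ᵇ v}) tu
...     | u<v , cu≡k = u , toWitness u<v ,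
          trans (cong toℕ (toWitness cu≡k)) (trans (Finₚ.toℕ-inject₁ k) (suc-injective cv≡1+m))

canonical⁺ : ∀ {i n} (c : Vec (Fin i) n) → Canonical c → T (canonical c)
canonical⁺ {zero}  c _ = tt
canonical⁺ {suc i} c can = all-allFin⁺ _ first-in-block
  where
  first-in-block : ∀ v → T (canonicalᵇ (lookup c v) c v)
  first-in-block v with lookup c v in cv≡
  ... | zero  = tt
  ... | suc k with can v (toℕ k) (cong toℕ cv≡)
  ...   | u , u<v , cu≡k = any-allFin⁺ _ u (from (T-∧ {u <ᵇ v}) (fromWitness u<v ,
          fromWitness (Finₚ.toℕ-injective (trans cu≡k (≡.sym (Finₚ.toℕ-inject₁ k))))))

T-partition⁻ : ∀ {i n} (G : Graph n) (c : Vec (Fin i) n) → T (partitionᵇ G c) → IsPartition G c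
T-partition⁻ G c t with to (T-∧ {proper G c}) t
... | tp , t′ with to (T-∧ {surjective c}) t′
...   | ts , tc = record
  { isProper = proper⁻ G c tp ; isOnto = onto⁻ c ts ; isCanonical = canonical⁻ c tc }

T-partition⁺ : ∀ {i n} {G : Graph n} {c : Vec (Fin i) n} → IsPartition G c → T (partitionᵇ G c)
T-partition⁺ {G = G} {c} P =
  from T-∧ (proper⁺ G c (isProper P) , from T-∧ (onto⁺ c (isOnto P) , canonical⁺ c (isCanonical P)))

a≡∑ᵛ : ∀ i {n} (G : Graph n) → a i G ≡ ∑ᵛ (λ c → ⟦ partitionᵇ G c ⟧)
a≡∑ᵛ i {n} G = count-allVecs n (partitionᵇ G)

onto⇒≤ : ∀ {i n} (c : Vec (Fin i) n) → Onto c → i ≤ n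
onto⇒≤ {i} {n} c O with i ≤? n
... | yes i≤n = i≤n
... | no  i≰n with Finₚ.pigeonhole (≰⇒> i≰n) (proj₁ ∘ O)
...   | k₁ , k₂ , k₁<k₂ , w₁≡w₂ = ⊥-elim (<-irrefl (cong toℕ k₁≡k₂) k₁<k₂)
  where
  k₁≡k₂ : k₁ ≡ k₂
  k₁≡k₂ = trans (≡.sym (proj₂ (O k₁))) (trans (cong (lookup c) w₁≡w₂) (proj₂ (O k₂)))

a-vanishes : ∀ i {n} (G : Graph n) → n < i → a i G ≡ 0
a-vanishes i {n} G n<i = n≤0⇒n≡0 (begin
  a i G                              ≡⟨ a≡∑ᵛ i G ⟩
  ∑ᵛ (λ c → ⟦ partitionᵇ G c ⟧)     ≤⟨ ∑ᵛ-mono-≤ (λ c → ⟦⟧-mono {b′ = false} (no-partition c)) ⟩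
  ∑ᵛ {i} {n} (λ _ → 0)              ≡⟨ ∑ᵛ-zero n ⟩
  0                                  ∎)
  where
  open ≤-Reasoning
  no-partition : (c : Vec (Fin i) n) → T (partitionᵇ G c) → T false
  no-partition c t = <⇒≱ n<i (onto⇒≤ c (isOnto (T-partition⁻ G c t)))

canonical-below : ∀ {i n} (c : Vec (Fin i) n) → Canonical c → ∀ t w m →
  toℕ (lookup c w) ≡ t → m < t → ∃ λ u → toℕ u < toℕ w × toℕ (lookup c u) ≡ m
canonical-below c can (suc t) w m cw≡1+t m<1+t with can w t cw≡1+t | m≤n⇒m<n∨m≡n (s≤s⁻¹ m<1+t)
... | u , u<w , cu≡t | inj₂ refl = u , u<w , cu≡t
... | u , u<w , cu≡t | inj₁ m<t with canonical-below c can t u m cu≡t m<t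
...   | u′ , u′<u , cu′≡m = u′ , <-trans u′<u u<w , cu′≡m

-- Restricting a colouring of G to G − v

proper-∷ʳ⁻ : ∀ {i n} (G : Graph (suc n)) (c′ : Vec (Fin i) n) x →
             Proper G (c′ ∷ʳ x) → Proper (deleteLast G) c′
proper-∷ʳ⁻ G c′ x P u v uv cu≡cv = P (inject₁ u) (inject₁ v) uv
  (trans (lookup-∷ʳ-inject₁ c′ x u) (trans cu≡cv (≡.sym (lookup-∷ʳ-inject₁ c′ x v))))

onto-∷ʳ⁻ : ∀ {i n} (c′ : Vec (Fin i) n) x u → lookup c′ u ≡ x → Onto (c′ ∷ʳ x) → Onto c′
onto-∷ʳ⁻ c′ x u cu≡x O k with O k
... | w , cw≡k with inject₁-or-fromℕ w
...   | inj₁ (v , refl) = v , trans (≡.sym (lookup-∷ʳ-inject₁ c′ x v)) cw≡k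
...   | inj₂ refl       = u , trans cu≡x (trans (≡.sym (lookup-∷ʳ-fromℕ c′ x)) cw≡k)

canonical-∷ʳ⁻ : ∀ {i n} (c′ : Vec (Fin i) n) x → Canonical (c′ ∷ʳ x) → Canonical c′
canonical-∷ʳ⁻ c′ x can v m cv≡1+m
  with can (inject₁ v) m (trans (cong toℕ (lookup-∷ʳ-inject₁ c′ x v)) cv≡1+m)
... | w , w<v , cw≡m with below-inject₁ w v w<v
...   | u , refl , u<v = u , u<v , trans (cong toℕ (≡.sym (lookup-∷ʳ-inject₁ c′ x u))) cw≡m

same-colour⇒nonNeighbour : ∀ {i n} (G : Graph (suc n)) (c′ : Vec (Fin i) n) x u →
  Proper G (c′ ∷ʳ x) → lookup c′ u ≡ x → T (nonNeighbour G u)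
same-colour⇒nonNeighbour {n = n} G c′ x u P cu≡x = T-not⁺ λ uv → P (inject₁ u) (fromℕ n) uv
  (trans (lookup-∷ʳ-inject₁ c′ x u) (trans cu≡x (≡.sym (lookup-∷ʳ-fromℕ c′ x))))

partition-∷ʳ⁻ : ∀ {i n} (G : Graph (suc n)) (c′ : Vec (Fin i) n) x u →
  IsPartition G (c′ ∷ʳ x) → lookup c′ u ≡ x → IsPartition (deleteLast G) c′
partition-∷ʳ⁻ G c′ x u P cu≡x = record
  { isProper    = proper-∷ʳ⁻ G c′ x (isProper P)
  ; isOnto      = onto-∷ʳ⁻ c′ x u cu≡x (isOnto P)
  ; isCanonical = canonical-∷ʳ⁻ c′ x (isCanonical P)
  }

fresh-colour-is-top : ∀ {j n} (c′ : Vec (Fin (suc j)) n) x →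
  Onto (c′ ∷ʳ x) → Canonical (c′ ∷ʳ x) → (∀ u → lookup c′ u ≢ x) → x ≡ fromℕ j
fresh-colour-is-top {j} {n} c′ x O can fresh with m≤n⇒m<n∨m≡n (Finₚ.toℕ≤pred[n] x)
... | inj₂ x≡j = Finₚ.toℕ-injective (trans x≡j (≡.sym (Finₚ.toℕ-fromℕ j)))
... | inj₁ x<j with O (fromℕ j)
...   | w , cw≡j with canonical-below (c′ ∷ʳ x) can j w (toℕ x)
                        (trans (cong toℕ cw≡j) (Finₚ.toℕ-fromℕ j)) x<j
...     | u , u<w , cu≡x with toℕ<⇒inject₁ u (<-≤-trans u<w (Finₚ.toℕ≤pred[n] w))
...       | u′ , refl = ⊥-elim (fresh u′
  (trans (≡.sym (lookup-∷ʳ-inject₁ c′ x u′)) (Finₚ.toℕ-injective cu≡x)))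

avoidsTop⁺ : ∀ {j n} (c : Vec (Fin (suc j)) n) → (∀ u → lookup c u ≢ fromℕ j) → T (avoidsTop c)
avoidsTop⁺ []      _     = tt
avoidsTop⁺ (y ∷ c) avoid = from T-∧ (T-not⁺ (avoid zero ∘ toWitness) , avoidsTop⁺ c (avoid ∘ suc))

proper-map⁻ : ∀ {i i′ n} (G : Graph n) (f : Fin i → Fin i′) (d : Vec (Fin i) n) →
              Proper G (Vec.map f d) → Proper G d
proper-map⁻ G f d P u v uv du≡dv =
  P u v uv (trans (lookup-map u f d) (trans (cong f du≡dv) (≡.sym (lookup-map v f d))))

toℕ-lookup-map-inject₁ : ∀ {i n} (d : Vec (Fin i) n) v →
                         toℕ (lookup (Vec.map inject₁ d) v) ≡ toℕ (lookup d v)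
toℕ-lookup-map-inject₁ d v = trans (cong toℕ (lookup-map v inject₁ d)) (Finₚ.toℕ-inject₁ (lookup d v))

canonical-map-inject₁⁻ : ∀ {i n} (d : Vec (Fin i) n) → Canonical (Vec.map inject₁ d) → Canonical d
canonical-map-inject₁⁻ d can v m dv≡1+m with can v m (trans (toℕ-lookup-map-inject₁ d v) dv≡1+m)
... | u , u<v , du≡m = u , u<v , trans (≡.sym (toℕ-lookup-map-inject₁ d u)) du≡m

onto-lower : ∀ {j n} (d : Vec (Fin j) n) → Onto (Vec.map inject₁ d ∷ʳ fromℕ j) → Onto d
onto-lower {j} d O k with O (inject₁ k)
... | w , cw≡k with inject₁-or-fromℕ w
...   | inj₁ (v , refl) = v , Finₚ.inject₁-injective (trans (≡.sym (lookup-map v inject₁ d))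
          (trans (≡.sym (lookup-∷ʳ-inject₁ (Vec.map inject₁ d) (fromℕ j) v)) cw≡k))
...   | inj₂ refl = ⊥-elim (Finₚ.fromℕ≢inject₁
          (trans (≡.sym (lookup-∷ʳ-fromℕ (Vec.map inject₁ d) (fromℕ j))) cw≡k))

partition-lower : ∀ {j n} (G : Graph (suc n)) (d : Vec (Fin j) n) →
  IsPartition G (Vec.map inject₁ d ∷ʳ fromℕ j) → IsPartition (deleteLast G) d
partition-lower {j} G d P = record
  { isProper    = proper-map⁻ (deleteLast G) inject₁ d (proper-∷ʳ⁻ G c′ (fromℕ j) (isProper P))
  ; isOnto      = onto-lower d (isOnto P)
  ; isCanonical = canonical-map-inject₁⁻ d (canonical-∷ʳ⁻ c′ (fromℕ j) (isCanonical P))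
  }
  where
  c′ : Vec (Fin (suc j)) _
  c′ = Vec.map inject₁ d

-- The recurrence and the bound

-- The first summand accounts for x being a fresh colour, the second for x
-- being the colour of a non-neighbour u of the last vertex.
extension-bound : ∀ {j n} (G : Graph (suc n)) (c′ : Vec (Fin (suc j)) n) x →
  ⟦ partitionᵇ G (c′ ∷ʳ x) ⟧ ≤
    ⟦ fromℕ j == x ⟧ * (⟦ avoidsTop c′ ⟧ * ⟦ partitionᵇ G (c′ ∷ʳ fromℕ j) ⟧)
    + ⟦ partitionᵇ (deleteLast G) c′ ⟧ * ∑[ u < n ] (⟦ lookup c′ u == x ⟧ * ⟦ nonNeighbour G u ⟧)
extension-bound {j} {n} G c′ x with partitionᵇ G (c′ ∷ʳ x) in p≡
... | false = z≤n
... | true with T-partition⁻ G (c′ ∷ʳ x) (from T-≡ p≡) | Finₚ.any? (λ u → lookup c′ u Finₚ.≟ x)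
...   | P | yes (u , cu≡x) = ≤-trans second≥1 (m≤n+m _ _)
  where
  S : ℕ
  S = ∑[ u < n ] (⟦ lookup c′ u == x ⟧ * ⟦ nonNeighbour G u ⟧)
  term-u : ⟦ lookup c′ u == x ⟧ * ⟦ nonNeighbour G u ⟧ ≡ 1
  term-u = cong₂ _*_ (T⇒⟦⟧≡1 (lookup c′ u == x) (fromWitness cu≡x))
                     (T⇒⟦⟧≡1 (nonNeighbour G u) (same-colour⇒nonNeighbour G c′ x u (isProper P) cu≡x))
  second≥1 : 1 ≤ ⟦ partitionᵇ (deleteLast G) c′ ⟧ * S
  second≥1 rewrite T⇒⟦⟧≡1 (partitionᵇ (deleteLast G) c′) (T-partition⁺ (partition-∷ʳ⁻ G c′ x u P cu≡x)) =
    ≤-trans (≤-trans (≤-reflexive (≡.sym term-u)) (term≤sum _ u)) (m≤m+n S 0)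
...   | P | no unused with fresh-colour-is-top c′ x (isOnto P) (isCanonical P) (λ u cu≡x → unused (u , cu≡x))
...     | refl = ≤-trans (≤-reflexive (≡.sym first≡1)) (m≤m+n _ _)
  where
  first≡1 : ⟦ fromℕ j == fromℕ j ⟧ * (⟦ avoidsTop c′ ⟧ * ⟦ partitionᵇ G (c′ ∷ʳ fromℕ j) ⟧) ≡ 1
  first≡1 = cong₂ _*_ (T⇒⟦⟧≡1 (fromℕ j == fromℕ j) (fromWitness refl)) (cong₂ _*_
    (T⇒⟦⟧≡1 (avoidsTop c′) (avoidsTop⁺ c′ (λ u cu≡x → unused (u , cu≡x))))
    (T⇒⟦⟧≡1 (partitionᵇ G (c′ ∷ʳ fromℕ j)) (from T-≡ p≡)))

extensions-bound : ∀ {j n} (G : Graph (suc n)) (c′ : Vec (Fin (suc j)) n) →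
  ∑[ x < suc j ] ⟦ partitionᵇ G (c′ ∷ʳ x) ⟧ ≤
    ⟦ avoidsTop c′ ⟧ * ⟦ partitionᵇ G (c′ ∷ʳ fromℕ j) ⟧ + ⟦ partitionᵇ (deleteLast G) c′ ⟧ * nonDegree G
extensions-bound {j} {n} G c′ = begin
  ∑[ x < suc j ] ⟦ partitionᵇ G (c′ ∷ʳ x) ⟧  ≤⟨ sum-mono-≤ (extension-bound G c′) ⟩
  ∑[ x < suc j ] (fresh x + shared x)          ≡⟨ ∑-distrib-+ fresh shared ⟩
  sum fresh + sum shared                       ≡⟨ cong₂ _+_ (sum-indicator (fromℕ j) K) sum-shared ⟩
  K + P′ * nonDegree G                         ∎
  where
  open ≤-Reasoning
  K P′ : ℕ
  K = ⟦ avoidsTop c′ ⟧ * ⟦ partitionᵇ G (c′ ∷ʳ fromℕ j) ⟧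
  P′ = ⟦ partitionᵇ (deleteLast G) c′ ⟧
  fresh shared : Fin (suc j) → ℕ
  fresh x = ⟦ fromℕ j == x ⟧ * K
  shared x = P′ * ∑[ u < n ] (⟦ lookup c′ u == x ⟧ * ⟦ nonNeighbour G u ⟧)
  sum-shared : sum shared ≡ P′ * nonDegree G
  sum-shared = trans
    (≡.sym (*-distribˡ-sum P′ (λ x → ∑[ u < n ] (⟦ lookup c′ u == x ⟧ * ⟦ nonNeighbour G u ⟧))))
    (cong (P′ *_) (sum-fibres (lookup c′) (λ u → ⟦ nonNeighbour G u ⟧)))

a-recurrence : ∀ {j n} (G : Graph (suc n)) →
               a (suc j) G ≤ a j (deleteLast G) + a (suc j) (deleteLast G) * nonDegree G
a-recurrence {j} {n} G = begin
  a (suc j) G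
    ≡⟨ trans (a≡∑ᵛ (suc j) G) (∑ᵛ-∷ʳ n (λ c → ⟦ partitionᵇ G c ⟧)) ⟩
  ∑ᵛ (λ c′ → ∑[ x < suc j ] ⟦ partitionᵇ G (c′ ∷ʳ x) ⟧)
    ≤⟨ ∑ᵛ-mono-≤ (extensions-bound G) ⟩
  ∑ᵛ (λ c′ → fresh c′ + shared c′)
    ≡⟨ ∑ᵛ-distrib-+ fresh shared ⟩
  ∑ᵛ fresh + ∑ᵛ shared
    ≡⟨ cong₂ _+_ (∑ᵛ-avoidsTop n _) (≡.sym (*-distribʳ-∑ᵛ (nonDegree G) P′)) ⟩
  ∑ᵛ (λ d → ⟦ partitionᵇ G (Vec.map inject₁ d ∷ʳ fromℕ j) ⟧) + ∑ᵛ P′ * nonDegree G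
    ≤⟨ +-monoˡ-≤ _ (∑ᵛ-mono-≤ lower) ⟩
  ∑ᵛ (λ d → ⟦ partitionᵇ (deleteLast G) d ⟧) + ∑ᵛ P′ * nonDegree G
    ≡⟨ ≡.sym (cong₂ (λ A B → A + B * nonDegree G) (a≡∑ᵛ j (deleteLast G)) (a≡∑ᵛ (suc j) (deleteLast G))) ⟩
  a j (deleteLast G) + a (suc j) (deleteLast G) * nonDegree G ∎
  where
  open ≤-Reasoning
  P′ fresh shared : Vec (Fin (suc j)) n → ℕ
  P′ c′ = ⟦ partitionᵇ (deleteLast G) c′ ⟧
  fresh c′ = ⟦ avoidsTop c′ ⟧ * ⟦ partitionᵇ G (c′ ∷ʳ fromℕ j) ⟧
  shared c′ = P′ c′ * nonDegree G
  lower : ∀ d → ⟦ partitionᵇ G (Vec.map inject₁ d ∷ʳ fromℕ j) ⟧ ≤ ⟦ partitionᵇ (deleteLast G) d ⟧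
  lower d = ⟦⟧-mono (T-partition⁺ ∘ partition-lower G d ∘ T-partition⁻ G (Vec.map inject₁ d ∷ʳ fromℕ j))

binomial-lower-bound : ∀ N k q → N ^ suc q + suc q * k * N ^ q ≤ (N + k) ^ suc q
binomial-lower-bound N k zero    = ≤-reflexive (linear N k)
  where
  linear : ∀ N k → N * 1 + 1 * k * 1 ≡ (N + k) * 1
  linear = solve-∀
binomial-lower-bound N k (suc q) = begin
  N ^ (2 + q) + (2 + q) * k * N ^ (1 + q)
    ≤⟨ m≤m+n _ ((1 + q) * k * k * N ^ q) ⟩
  N ^ (2 + q) + (2 + q) * k * N ^ (1 + q) + (1 + q) * k * k * N ^ q
    ≡⟨ expand N k q (N ^ q) ⟩
  (N + k) * (N ^ (1 + q) + (1 + q) * k * N ^ q)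
    ≤⟨ *-monoʳ-≤ (N + k) (binomial-lower-bound N k q) ⟩
  (N + k) ^ (2 + q) ∎
  where
  open ≤-Reasoning
  expand : ∀ N k q Y → N * (N * Y) + (2 + q) * k * (N * Y) + (1 + q) * k * k * Y
                       ≡ (N + k) * (N * Y + (1 + q) * k * Y)
  expand = solve-∀

recurrence-bound : ∀ {A A₀ A₁ N k} q → A ≤ A₀ + A₁ * k →
  A₀ * (suc q) ! ≤ N ^ suc q → A₁ * q ! ≤ N ^ q → A * (suc q) ! ≤ (N + k) ^ suc q
recurrence-bound {A} {A₀} {A₁} {N} {k} q A≤ bound₀ bound₁ = begin
  A * (suc q) !                                ≤⟨ *-monoˡ-≤ ((suc q) !) A≤ ⟩
  (A₀ + A₁ * k) * (suc q * q !)                ≡⟨ distribute A₀ A₁ k (suc q) (q !) ⟩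
  A₀ * (suc q * q !) + suc q * k * (A₁ * q !)  ≤⟨ +-mono-≤ bound₀ (*-monoʳ-≤ (suc q * k) bound₁) ⟩
  N ^ suc q + suc q * k * N ^ q                ≤⟨ binomial-lower-bound N k q ⟩
  (N + k) ^ suc q                              ∎
  where
  open ≤-Reasoning
  distribute : ∀ A₀ A₁ k s F → (A₀ + A₁ * k) * (s * F) ≡ A₀ * (s * F) + s * k * (A₁ * F)
  distribute = solve-∀

partitions-bound : ∀ n (G : Graph n) i → a i G * (n ∸ i) ! ≤ nonEdges G ^ (n ∸ i)
partitions-bound zero    G zero    = ≤-trans (≤-reflexive (*-identityʳ (a 0 G))) (⟦⟧≤1 _)
partitions-bound zero    G (suc i) = ≤-trans (≤-reflexive (*-identityʳ (a (suc i) G))) (⟦⟧≤1 _)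
partitions-bound (suc n) G zero    = z≤n
partitions-bound (suc n) G (suc j) = step (n ∸ j) refl
  where
  G′ : Graph n
  G′ = deleteLast G
  bound : ∀ i {d} → n ∸ i ≡ d → a i G′ * d ! ≤ nonEdges G′ ^ d
  bound i n∸i≡d = subst (λ d → a i G′ * d ! ≤ nonEdges G′ ^ d) n∸i≡d (partitions-bound n G′ i)
  step : ∀ d → n ∸ j ≡ d → a (suc j) G * d ! ≤ nonEdges G ^ d
  step zero n∸j≡0 = begin
    a (suc j) G * 1                                 ≡⟨ *-identityʳ _ ⟩
    a (suc j) G                                     ≤⟨ a-recurrence G ⟩
    a j G′ + a (suc j) G′ * nonDegree G             ≡⟨ cong (λ A → a j G′ + A * nonDegree G) none ⟩
    a j G′ + 0                                      ≡⟨ trans (+-identityʳ _) (≡.sym (*-identityʳ _)) ⟩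
    a j G′ * 1                                      ≤⟨ bound j n∸j≡0 ⟩
    1                                               ∎
    where
    open ≤-Reasoning
    none : a (suc j) G′ ≡ 0
    none = a-vanishes (suc j) G′ (s≤s (m∸n≡0⇒m≤n n∸j≡0))
  step (suc q) n∸j≡1+q = subst (λ N → a (suc j) G * (suc q) ! ≤ N ^ suc q)
    (≡.sym (nonEdges-deleteLast G))
    (recurrence-bound {A₀ = a j G′} {a (suc j) G′} {nonEdges G′} {nonDegree G} q
      (a-recurrence G) (bound j n∸j≡1+q) (bound (suc j) (trans (≡.sym (pred[m∸n]≡m∸[1+n] n j)) (cong pred n∸j≡1+q))))

-- The bound holds for every i.
lemma6 : (n : ℕ) (G : Graph n) (i : ℕ) → 1 ≤ i → i ≤ n ∸ 1 →
    a i G * (n ∸ i) ! ≤ ((n C 2) ∸ size G) ^ (n ∸ i)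
lemma6 n G i _ _ = subst (λ N → a i G * (n ∸ i) ! ≤ N ^ (n ∸ i))
  (≡.sym (C2∸size≡nonEdges G)) (partitions-bound n G i)
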